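{- For every positive integer $x$ there exists at least one SP number strictly between $x^2$ and $(x+2)^2$.
   Context: An SP number (square-prime number) is a natural number of the form $p\cdot a^2$ where $p$ is a prime and $a\geq 2$ is a natural number (i.e. $a\neq 1$). -}

module Defs where

open import Data.Nat using (ℕ; _*_; _≥_)
open import Data.Nat.Primality using (Prime)
open import Data.Product using (∃₂; _×_)
open import Relation.Binary.PropositionalEquality using (_≡_)

SP : ℕ → Set
SP n = ∃₂ λ p a → Prime p × a ≥ 2 × n ≡ p * (a * a)

-- Consecutive numbers 2a² differ by 2(2a + 1), which is less than the gap 4x + 4
-- between x² and (x + 2)². So the least 2a² above x² is still below (x + 2)²;
-- for x ≥ 2 this a is at least 2, and for x = 1 the number 8 = 2·2² works.
module Submission where

open import Defs
open import Data.Nat using (ℕ; zero; suc; _+_; _*_; _^_; _≤_; _<_; z≤n; s≤s; z<s; NonZero; _<?_)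
open import Data.Nat.Properties
open import Data.Nat.Primality using (Prime; prime[2])
open import Data.Nat.Solver using (module +-*-Solver)
open +-*-Solver using (solve; _:=_; _:+_; _:*_; _:^_; con)
open import Data.Product using (∃; _×_; _,_)
open import Relation.Nullary using (yes; no)
open import Relation.Binary.PropositionalEquality using (_≡_; refl; cong; sym)

^-cancelˡ-≤ : ∀ e .{{_ : NonZero e}} {m n} → m ^ e ≤ n ^ e → m ≤ n
^-cancelˡ-≤ e mᵉ≤nᵉ = ≮⇒≥ (λ n<m → <⇒≱ (^-monoˡ-< e n<m) mᵉ≤nᵉ)

k*m²≤n²⇒m≤n : ∀ k .{{_ : NonZero k}} {m n} → k * m ^ 2 ≤ n ^ 2 → m ≤ n
k*m²≤n²⇒m≤n k km²≤n² = ^-cancelˡ-≤ 2 (≤-trans (m≤n*m _ k) km²≤n²)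

∃k*b²≤n<k*[1+b]² : ∀ k .{{_ : NonZero k}} n → ∃ λ b → k * b ^ 2 ≤ n × n < k * suc b ^ 2
∃k*b²≤n<k*[1+b]² k zero = 0 , ≤-reflexive (*-zeroʳ k) , m≤n*m 1 k
∃k*b²≤n<k*[1+b]² k (suc n) with ∃k*b²≤n<k*[1+b]² k n
... | b , lo , hi with suc n <? k * suc b ^ 2
...   | yes hi′ = b , m≤n⇒m≤1+n lo , hi′
...   | no ¬hi′ = suc b , ≮⇒≥ ¬hi′ ,
          ≤-<-trans hi (*-monoʳ-< k (^-monoˡ-< 2 (n<1+n (suc b))))

expand-2*[1+b]² : ∀ b → 2 * (1 + b) ^ 2 ≡ 2 * b ^ 2 + 4 * b + 2
expand-2*[1+b]² = solve 1 (λ b → con 2 :* (con 1 :+ b) :^ 2 := con 2 :* b :^ 2 :+ con 4 :* b :+ con 2) refl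

expand-[x+2]² : ∀ x → (x + 2) ^ 2 ≡ x ^ 2 + 4 * x + 2 + 2
expand-[x+2]² = solve 1 (λ x → (x :+ con 2) :^ 2 := x :^ 2 :+ con 4 :* x :+ con 2 :+ con 2) refl

2*b²≤x²⇒2*[1+b]²<[x+2]² : ∀ b x → 2 * b ^ 2 ≤ x ^ 2 → 2 * suc b ^ 2 < (x + 2) ^ 2
2*b²≤x²⇒2*[1+b]²<[x+2]² b x 2b²≤x² = begin-strict
  2 * suc b ^ 2          ≡⟨ expand-2*[1+b]² b ⟩
  2 * b ^ 2 + 4 * b + 2  ≤⟨ +-monoˡ-≤ 2 (+-mono-≤ 2b²≤x² (*-monoʳ-≤ 4 b≤x)) ⟩
  x ^ 2 + 4 * x + 2      <⟨ m<m+n _ z<s ⟩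
  x ^ 2 + 4 * x + 2 + 2  ≡⟨ sym (expand-[x+2]² x) ⟩
  (x + 2) ^ 2            ∎
  where
  open ≤-Reasoning
  b≤x : b ≤ x
  b≤x = k*m²≤n²⇒m≤n 2 2b²≤x²

prime*square-SP : ∀ {p a} → Prime p → 2 ≤ a → SP (p * a ^ 2)
prime*square-SP {p} {a} p-prime 2≤a =
  p , a , p-prime , 2≤a , cong (λ t → p * (a * t)) (*-identityʳ a)

theorem2p3 : (x : ℕ) → 1 ≤ x →
    ∃ λ n → x ^ 2 < n × n < (x + 2) ^ 2 × SP n
theorem2p3 1 _ = 8 , s≤s (s≤s z≤n) , ≤-refl , prime*square-SP prime[2] ≤-refl
theorem2p3 x@(suc (suc _)) _ with ∃k*b²≤n<k*[1+b]² 2 (x ^ 2)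
... | zero , _ , s≤s (s≤s ())
... | b@(suc _) , 2b²≤x² , x²<2[1+b]² =
  2 * suc b ^ 2 , x²<2[1+b]² , 2*b²≤x²⇒2*[1+b]²<[x+2]² b x 2b²≤x² ,
  prime*square-SP {a = suc b} prime[2] (s≤s (s≤s z≤n))
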